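{- Let $r\ge 2$ and let $GT(r)$ be the glued binary tree of depth $r$, with copies $T_r^{(1)},T_r^{(2)}$, quasi-leaf set $L$, and $V_r^{(1)}=V(T_r^{(1)})\setminus L$. Let $S$ be a mutual-visibility set of $GT(r)$ with $|S\cap V_r^{(1)}|\ge 2$. Then to each vertex $v\in S\cap V_r^{(1)}$ one can assign a pair of twin quasi-leaves lying in $T_v$ and not belonging to $S$, in such a way that the pairs assigned to distinct vertices of $S\cap V_r^{(1)}$ are pairwise disjoint.
   Context: A perfect binary tree of depth $r$ is a rooted tree in which every non-leaf vertex has exactly 2 children and all leaves have depth $r$. $GT(r)$ is obtained from two copies $T_r^{(1)},T_r^{(2)}$ of it by identifying each leaf of $T_r^{(1)}$ with the corresponding leaf (under the natural isomorphism) of $T_r^{(2)}$; the identified vertices are the quasi-leaves, forming the set $L$. Two quasi-leaves $u,v$ are twin quasi-leaves if $N(u)=N(v)$. For a vertex $u$ of $T_r^{(i)}$, $T_u$ denotes the subtree of $T_r^{(i)}$ rooted at $u$ consisting of $u$ and all its descendants (its leaves are quasi-leaves). For $S\subseteq V(G)$, two vertices $u,v$ are $S$-visible if there exists a shortest $u,v$-path $P$ with $V(P)\cap S\subseteq\{u,v\}$; $S$ is a mutual-visibility set if every two vertices of $S$ are $S$-visible. -}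

module Defs where

open import Data.Empty using (⊥)
open import Data.Bool using (Bool; true; false)
open import Data.Nat using (ℕ; zero; suc; _<_; _≤_)
open import Data.List using (List; []; _∷_; _++_; [_]; length)
open import Data.List.Relation.Unary.All using (All)
open import Data.Product using (Σ; ∃; _×_; _,_)
open import Data.Sum using (_⊎_)
open import Relation.Binary.PropositionalEquality using (_≡_)
open import Function.Bundles using (_⇔_)

-- Vertices of GT(r).
--  * A vertex of the perfect binary tree of depth r is identified with the
--    binary string (List Bool) describing the path from the root to it;
--    its depth is the length of the string.
--  * node c w : non-leaf vertex w of copy c  (c = true is T_r^(1),
--    c = false is T_r^(2)); valid iff length w < r.
--  * qleaf w  : quasi-leaf (the identified leaf w of both copies);
--    valid iff length w ≡ r.
data Vtx : Set where
  node  : Bool → List Bool → Vtx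
  qleaf : List Bool → Vtx

Valid : ℕ → Vtx → Set
Valid r (node c w) = length w < r
Valid r (qleaf w)  = length w ≡ r

data ParentOf (r : ℕ) : Vtx → Vtx → Set where
  toNode : ∀ c w b → suc (length w) < r → ParentOf r (node c w) (node c (w ++ [ b ]))
  toLeaf : ∀ c w b → suc (length w) ≡ r → ParentOf r (node c w) (qleaf (w ++ [ b ]))

Edge : ℕ → Vtx → Vtx → Set
Edge r u v = ParentOf r u v ⊎ ParentOf r v u

data Walk (r : ℕ) : Vtx → Vtx → ℕ → Set where
  here : ∀ {u} → Walk r u u 0
  step : ∀ {u w v n} → Edge r u w → Walk r w v n → Walk r u v (suc n)

verts : ∀ {r u v n} → Walk r u v n → List Vtx
verts {u = u} here = u ∷ []
verts {u = u} (step e p) = u ∷ verts p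

Shortest : ∀ {r u v n} → Walk r u v n → Set
Shortest {r} {u} {v} {n} _ = ∀ m → Walk r u v m → n ≤ m

Visible : ℕ → (Vtx → Set) → Vtx → Vtx → Set
Visible r S u v =
  ∃ λ n → Σ (Walk r u v n) λ P →
    Shortest P × All (λ x → S x → (x ≡ u) ⊎ (x ≡ v)) (verts P)

IsMutualVisibility : ℕ → (Vtx → Set) → Set
IsMutualVisibility r S =
  (∀ x → S x → Valid r x) × (∀ u v → S u → S v → Visible r S u v)

InV1 : ℕ → Vtx → Set
InV1 r (node true w) = length w < r
InV1 r (node false w) = ⊥
InV1 r (qleaf w) = ⊥

IsQuasiLeaf : ℕ → Vtx → Set
IsQuasiLeaf r (qleaf w) = length w ≡ r
IsQuasiLeaf r (node _ _) = ⊥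

SameNeighbourhood : ℕ → Vtx → Vtx → Set
SameNeighbourhood r u v = ∀ x → Edge r x u ⇔ Edge r x v

-- x is a vertex of T_v (subtree of v's copy rooted at v; its leaves are quasi-leaves)
InSubtree : Vtx → Vtx → Set
InSubtree (node c w) (node c' w') = c ≡ c' × ∃ λ s → w' ≡ w ++ s
InSubtree (node c w) (qleaf w')   = ∃ λ s → w' ≡ w ++ s
InSubtree (qleaf w)  (qleaf w')   = w ≡ w'
InSubtree (qleaf w)  (node _ _)   = ⊥

{-# OPTIONS --safe #-}
-- A shortest path in GT(r) from a vertex x of T₁ (non-leaf or quasi-leaf) to a vertex q of V₁ never
-- enters the second copy and follows the tree path, so it passes through every ancestor p of x that
-- does not have q below it on the side of x. When p and q lie in S that path is blocked: S has
-- nothing below p on any side away from q. To w ∈ S ∩ V₁ assign the two children of the vertex of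
-- depth r ∸ 1 reached from w by stepping first away from another vertex u of S ∩ V₁ (if u lies
-- below w) and then always left. They are twin quasi-leaves of T_w and, by blocking, outside S.
-- If w ≠ w′ shared an assigned quasi-leaf, one of them would lie below the other on the side of
-- that leaf, which is away from the vertex u chosen for the other, again contradicting blocking.
module Submission where

open import Defs
open import Data.Nat using (ℕ; _≤_)
open import Data.Product using (Σ; ∃; _×_; _,_; proj₁; proj₂)
open import Relation.Binary.PropositionalEquality using (_≡_; _≢_)
open import Relation.Nullary using (¬_)

open import Data.Bool using (Bool; true; false; not)
open import Data.Bool.Properties using (_≟_; not-¬)
open import Data.Empty using (⊥; ⊥-elim)
open import Data.List using (List; []; _∷_; _++_; [_]; _∷ʳ_; length; replicate)
open import Data.List.Properties
  using (∷-injective; ∷-injectiveʳ; ++-assoc; ++-identityʳ; ++-cancelˡ; ++-identityʳ-unique;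
         ∷ʳ-++; ≡-dec; ∷ʳ-injectiveˡ; ∷ʳ-injectiveʳ; length-++; length-replicate)
open import Data.List.Membership.Propositional using (_∈_)
open import Data.List.Relation.Unary.All using (lookup)
open import Data.List.Relation.Unary.Any using (here; there)
open import Data.List.Reverse using (Reverse; reverseView; []; _∶_∶ʳ_)
open import Data.Nat using (suc; _+_; _<_; _∸_; z≤n; s≤s; s≤s⁻¹)
open import Data.Nat.Properties
  using (≤-refl; ≤-reflexive; ≤-trans; ≤-<-trans; <⇒≤; n≤1+n; 1+n≰n; +-comm; m+[n∸m]≡n)
open import Data.Product using (∃₂; map)
open import Data.Sum using (_⊎_; inj₁; inj₂)
open import Function.Bundles using (mk⇔)
open import Relation.Binary.PropositionalEquality using (refl; sym; trans; cong; subst; module ≡-Reasoning)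
open import Relation.Nullary using (Dec; yes; no; contradiction)
open import Relation.Nullary.Decidable using (map′)

-- Addresses in the binary tree

∷ʳ-as-∷ : ∀ (t : List Bool) b → ∃₂ λ c t′ → t ∷ʳ b ≡ c ∷ t′
∷ʳ-as-∷ [] b = b , [] , refl
∷ʳ-as-∷ (c ∷ t) b = c , t ∷ʳ b , refl

length-∷ʳ : ∀ (w : List Bool) b → length (w ∷ʳ b) ≡ suc (length w)
length-∷ʳ w b = trans (length-++ w) (+-comm (length w) 1)

InBranch : List Bool → Bool → List Bool → Set
InBranch w c q = ∃ λ t → q ≡ w ++ c ∷ t

InBranch-longer : ∀ {w c q} → InBranch w c q → length w < length q
InBranch-longer {[]} (t , refl) = s≤s z≤n
InBranch-longer {x ∷ w} (t , refl) = s≤s (InBranch-longer {w} (t , refl))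

InBranch-irrefl : ∀ {w c} → ¬ InBranch w c w
InBranch-irrefl {w} (t , w≡w++c∷t) with () ← ++-identityʳ-unique w w≡w++c∷t

InBranch-functional : ∀ {w c d q} → InBranch w c q → InBranch w d q → c ≡ d
InBranch-functional {w} (t , refl) (t′ , eq) = proj₁ (∷-injective (++-cancelˡ w _ _ eq))

InBranch-trans : ∀ {p c w b q} → InBranch p c w → InBranch w b q → InBranch p c q
InBranch-trans {p} {c} {b = b} (t , refl) (t′ , refl) = t ++ b ∷ t′ , ++-assoc p (c ∷ t) (b ∷ t′)

InBranch-parent : ∀ {p c w b} → InBranch p c (w ∷ʳ b) → w ≡ p ⊎ InBranch p c w
InBranch-parent {p} {c} {w} (t , eq) with reverseView t
... | [] = inj₁ (∷ʳ-injectiveˡ w p eq)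
... | t₀ ∶ _ ∶ʳ d =
  inj₂ (t₀ , ∷ʳ-injectiveˡ w (p ++ c ∷ t₀) (trans eq (sym (++-assoc p (c ∷ t₀) [ d ]))))

InBranch-child : ∀ {w b q} → InBranch w b q → q ≡ w ∷ʳ b ⊎ ∃ λ c → InBranch (w ∷ʳ b) c q
InBranch-child ([] , refl) = inj₁ refl
InBranch-child {w} {b} (c ∷ t , refl) = inj₂ (c , t , sym (∷ʳ-++ w b (c ∷ t)))

Below : List Bool → List Bool → Set
Below w q = ∃ λ c → InBranch w c q

root-Below : ∀ {q} → q ≢ [] → Below [] q
root-Below {[]} q≢[] = contradiction refl q≢[]
root-Below {c ∷ t} _ = c , t , refl

parent-¬InBranch : ∀ {w b q} → q ≢ w ∷ʳ b → ¬ Below (w ∷ʳ b) q → ¬ InBranch w b q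
parent-¬InBranch q≢w∷ʳb ¬below q-branch with InBranch-child q-branch
... | inj₁ q≡w∷ʳb = q≢w∷ʳb q≡w∷ʳb
... | inj₂ below = ¬below below

below? : ∀ w q → Dec (Below w q)
below? [] [] = no λ { (_ , _ , ()) }
below? [] (c ∷ t) = yes (c , t , refl)
below? (x ∷ w) [] = no λ { (_ , _ , ()) }
below? (x ∷ w) (y ∷ q) with x ≟ y
... | no x≢y = no λ { (_ , _ , eq) → x≢y (sym (proj₁ (∷-injective eq))) }
... | yes refl = map′ (λ { (c , t , eq) → c , t , cong (x ∷_) eq })
                      (λ { (c , t , eq) → c , t , ∷-injectiveʳ eq }) (below? w q)

extensions-comparable : ∀ w w′ {c c′ t t′} → w ++ c ∷ t ≡ w′ ++ c′ ∷ t′ →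
                        w ≡ w′ ⊎ InBranch w c w′ ⊎ InBranch w′ c′ w
extensions-comparable [] [] eq = inj₁ refl
extensions-comparable [] (y ∷ w′) eq with refl ← proj₁ (∷-injective eq) = inj₂ (inj₁ (w′ , refl))
extensions-comparable (x ∷ w) [] eq with refl ← proj₁ (∷-injective eq) = inj₂ (inj₂ (w , refl))
extensions-comparable (x ∷ w) (y ∷ w′) eq
  with refl , eq′ ← ∷-injective eq
  with extensions-comparable w w′ eq′
... | inj₁ refl = inj₁ refl
... | inj₂ (inj₁ (t , refl)) = inj₂ (inj₁ (t , refl))
... | inj₂ (inj₂ (t , refl)) = inj₂ (inj₂ (t , refl))

-- Tree distance

treeDist : List Bool → List Bool → ℕ
treeDist [] q = length q
treeDist (x ∷ s) [] = length (x ∷ s)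
treeDist (x ∷ s) (y ∷ q) with x ≟ y
... | yes _ = treeDist s q
... | no _ = length (x ∷ s) + length (y ∷ q)

treeDist-self : ∀ q → treeDist q q ≡ 0
treeDist-self [] = refl
treeDist-self (x ∷ q) with x ≟ x
... | yes _ = treeDist-self q
... | no x≢x = contradiction refl x≢x

treeDist-prefix : ∀ s t → treeDist s (s ++ t) ≡ length t
treeDist-prefix [] t = refl
treeDist-prefix (x ∷ s) t with x ≟ x
... | yes _ = treeDist-prefix s t
... | no x≢x = contradiction refl x≢x

treeDist-∷ʳ-away : ∀ w b q → ¬ InBranch w b q → treeDist (w ∷ʳ b) q ≡ suc (treeDist w q)
treeDist-∷ʳ-away [] b [] _ = refl
treeDist-∷ʳ-away [] b (y ∷ q) ∉ with b ≟ y
... | yes refl = contradiction (q , refl) ∉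
... | no _ = refl
treeDist-∷ʳ-away (x ∷ w) b [] _ = cong suc (length-∷ʳ w b)
treeDist-∷ʳ-away (x ∷ w) b (y ∷ q) ∉ with x ≟ y
... | yes refl = treeDist-∷ʳ-away w b q λ { (t , eq) → ∉ (t , cong (x ∷_) eq) }
... | no _ = cong (λ n → suc n + length (y ∷ q)) (length-∷ʳ w b)

treeDist-∷ʳ-toward : ∀ w b q → InBranch w b q → treeDist w q ≡ suc (treeDist (w ∷ʳ b) q)
treeDist-∷ʳ-toward w b q (t , refl) = begin
  treeDist w (w ++ b ∷ t)               ≡⟨ treeDist-prefix w (b ∷ t) ⟩
  suc (length t)                    ≡⟨ cong suc (treeDist-prefix (w ∷ʳ b) t) ⟨
  suc (treeDist (w ∷ʳ b) (w ∷ʳ b ++ t)) ≡⟨ cong (λ q → suc (treeDist (w ∷ʳ b) q)) (∷ʳ-++ w b t) ⟩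
  suc (treeDist (w ∷ʳ b) (w ++ b ∷ t))  ∎
  where open ≡-Reasoning

inBranch? : ∀ w b q → Dec (InBranch w b q)
inBranch? w b q with below? w q
... | no ¬below = no λ b-branch → ¬below (b , b-branch)
... | yes (c , c-branch) with c ≟ b
...   | yes refl = yes c-branch
...   | no c≢b = no λ b-branch → c≢b (InBranch-functional c-branch b-branch)

treeDist-∷ʳ-adjacent : ∀ w b q →
  treeDist (w ∷ʳ b) q ≤ suc (treeDist w q) × treeDist w q ≤ suc (treeDist (w ∷ʳ b) q)
treeDist-∷ʳ-adjacent w b q with inBranch? w b q
... | yes toward rewrite treeDist-∷ʳ-toward w b q toward = ≤-trans (n≤1+n _) (n≤1+n _) , ≤-refl
... | no away rewrite treeDist-∷ʳ-away w b q away = ≤-refl , ≤-trans (n≤1+n _) (n≤1+n _)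

≤-treeDist-parent : ∀ w b q {m} → suc m ≤ treeDist (w ∷ʳ b) q → m ≤ treeDist w q
≤-treeDist-parent w b q tight = s≤s⁻¹ (≤-trans tight (proj₁ (treeDist-∷ʳ-adjacent w b q)))

-- Shortest paths from T₁ to V₁

data T₁ : List Bool → Vtx → Set where
  node₁ : ∀ {s} → T₁ s (node true s)
  qleaf₁ : ∀ {s} → T₁ s (qleaf s)

-- The extra one on the second copy makes a step from a quasi-leaf into the second copy
-- non-decreasing, so walks as short as the tree distance stay in T₁.
potential : List Bool → Vtx → ℕ
potential q (node true s) = treeDist s q
potential q (node false s) = suc (treeDist s q)
potential q (qleaf s) = treeDist s q

verts-head : ∀ {r u v n} (P : Walk r u v n) → u ∈ verts P
verts-head here = here refl
verts-head (step _ _) = here refl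

module _ {r : ℕ} where

  last-level-¬InBranch : ∀ {w b q} → suc (length w) ≡ r → length q < r → ¬ InBranch w b q
  last-level-¬InBranch {q = q} w+1≡r q<r q-branch =
    1+n≰n (≤-trans (subst (length q <_) (sym w+1≡r) q<r) (InBranch-longer q-branch))

  potential-parent : ∀ {q u v} → length q < r → ParentOf r u v →
                     potential q v ≤ suc (potential q u) × potential q u ≤ suc (potential q v)
  potential-parent _ (toNode true w b _) = treeDist-∷ʳ-adjacent w b _
  potential-parent _ (toNode false w b _) = map s≤s s≤s (treeDist-∷ʳ-adjacent w b _)
  potential-parent _ (toLeaf true w b _) = treeDist-∷ʳ-adjacent w b _
  potential-parent {q} q<r (toLeaf false w b w+1≡r)
    rewrite treeDist-∷ʳ-away w b q (last-level-¬InBranch w+1≡r q<r) = n≤1+n _ , n≤1+n _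

  potential-edge : ∀ {q u v} → length q < r → Edge r u v → potential q u ≤ suc (potential q v)
  potential-edge q<r (inj₁ parent) = proj₂ (potential-parent q<r parent)
  potential-edge q<r (inj₂ child) = proj₁ (potential-parent q<r child)

  potential-walk : ∀ {q a n} → length q < r → Walk r a (node true q) n → potential q a ≤ n
  potential-walk {q} _ here = ≤-reflexive (treeDist-self q)
  potential-walk q<r (step e P) = ≤-trans (potential-edge q<r e) (s≤s (potential-walk q<r P))

  WalkWithin : ℕ → Vtx → Vtx → Set
  WalkWithin k u v = ∃ λ n → n ≤ k × Walk r u v n

  WalkWithin-step : ∀ {k u v w} → Edge r u v → WalkWithin k v w → WalkWithin (suc k) u w
  WalkWithin-step e (n , n≤k , W) = suc n , s≤s n≤k , step e W

  descend : ∀ s t {q} → q ≡ s ++ t → length q < r → Walk r (node true s) (node true q) (length t)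
  descend s [] refl _ rewrite ++-identityʳ s = here
  descend s (c ∷ t) refl q<r =
    step (inj₁ (toNode true s c (≤-<-trans (InBranch-longer {s} {c} (t , refl)) q<r)))
         (descend (s ∷ʳ c) t (sym (∷ʳ-++ s c t)) q<r)

  walk-from-node : ∀ {q s} → Reverse s → length s < r → length q < r →
                   WalkWithin (treeDist s q) (node true s) (node true q)
  walk-from-node {q} {s} rs s<r q<r with ≡-dec _≟_ q s | below? s q
  ... | yes refl | _ = 0 , z≤n , here
  ... | no _ | yes (c , t , refl) =
    suc (length t) , ≤-reflexive (sym (treeDist-prefix s (c ∷ t))) , descend s (c ∷ t) refl q<r
  walk-from-node [] _ _ | no q≢[] | no ¬below = contradiction (root-Below q≢[]) ¬below
  walk-from-node {q} (s₀ ∶ rs₀ ∶ʳ b) s<r q<r | no q≢s | no ¬below =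
    subst (λ k → WalkWithin k _ _) (sym (treeDist-∷ʳ-away s₀ b q (parent-¬InBranch q≢s ¬below)))
      (WalkWithin-step (inj₂ (toNode true s₀ b s₀+1<r)) (walk-from-node rs₀ (<⇒≤ s₀+1<r) q<r))
    where
    s₀+1<r : suc (length s₀) < r
    s₀+1<r = subst (_< r) (length-∷ʳ s₀ b) s<r

  walk-from-T₁ : ∀ {q s x} → length q < r → T₁ s x → Valid r x →
                 WalkWithin (treeDist s q) x (node true q)
  walk-from-T₁ q<r node₁ s<r = walk-from-node (reverseView _) s<r q<r
  walk-from-T₁ {q} {s} q<r qleaf₁ s≡r with reverseView s
  ... | [] with () ← subst (length q <_) (sym s≡r) q<r
  ... | s₀ ∶ rs₀ ∶ʳ b =
    subst (λ k → WalkWithin k _ _) (sym (treeDist-∷ʳ-away s₀ b q (last-level-¬InBranch s₀+1≡r q<r)))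
      (WalkWithin-step (inj₂ (toLeaf true s₀ b s₀+1≡r))
        (walk-from-node rs₀ (≤-reflexive s₀+1≡r) q<r))
    where
    s₀+1≡r : suc (length s₀) ≡ r
    s₀+1≡r = trans (sym (length-∷ʳ s₀ b)) s≡r

  no-descent-away : ∀ {p c q w b m} → InBranch p c w → ¬ InBranch p c q →
                    suc m ≤ treeDist w q → treeDist (w ∷ʳ b) q ≤ m → ⊥
  no-descent-away {q = q} {w} {b} {m} w-branch ¬q-branch tight bound =
    1+n≰n (≤-trans tight (≤-trans (n≤1+n _) (subst (_≤ m) away bound)))
    where
    away : treeDist (w ∷ʳ b) q ≡ suc (treeDist w q)
    away = treeDist-∷ʳ-away w b q λ q-branch → ¬q-branch (InBranch-trans w-branch q-branch)

  -- The bound forces every step to lower the potential: the walk can neither descend away from q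
  -- nor cross into the second copy, so it climbs until it reaches p.
  tight-walk-visits-ancestor : ∀ {p c q s x n} → length q < r → (P : Walk r x (node true q) n) →
                               T₁ s x → n ≤ treeDist s q → InBranch p c s → ¬ InBranch p c q →
                               node true p ∈ verts P
  tight-walk-visits-ancestor _ here node₁ _ q-branch ¬q-branch = contradiction q-branch ¬q-branch
  tight-walk-visits-ancestor q<r (step (inj₁ (toNode true w b _)) P) node₁ tight w-branch ¬q-branch =
    ⊥-elim (no-descent-away w-branch ¬q-branch tight (potential-walk q<r P))
  tight-walk-visits-ancestor q<r (step (inj₁ (toLeaf true w b _)) P) node₁ tight w-branch ¬q-branch =
    ⊥-elim (no-descent-away w-branch ¬q-branch tight (potential-walk q<r P))
  tight-walk-visits-ancestor {q = q} q<r (step (inj₂ (toNode true w b _)) P) node₁ tight s-branch ¬q-branch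
    with InBranch-parent s-branch
  ... | inj₁ refl = there (verts-head P)
  ... | inj₂ w-branch =
    there (tight-walk-visits-ancestor q<r P node₁ (≤-treeDist-parent w b q tight) w-branch ¬q-branch)
  tight-walk-visits-ancestor {q = q} q<r (step (inj₂ (toLeaf true w b _)) P) qleaf₁ tight s-branch ¬q-branch
    with InBranch-parent s-branch
  ... | inj₁ refl = there (verts-head P)
  ... | inj₂ w-branch =
    there (tight-walk-visits-ancestor q<r P node₁ (≤-treeDist-parent w b q tight) w-branch ¬q-branch)
  tight-walk-visits-ancestor {q = q} q<r (step {n = m} (inj₂ (toLeaf false w b w+1≡r)) P) qleaf₁ tight _ _ =
    ⊥-elim (1+n≰n (≤-trans (subst (suc m ≤_) away tight) (potential-walk q<r P)))
    where
    away : treeDist (w ∷ʳ b) q ≡ suc (treeDist w q)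
    away = treeDist-∷ʳ-away w b q (last-level-¬InBranch w+1≡r q<r)

  shortest-visits-ancestor : ∀ {p c q s x n} → length q < r → (P : Walk r x (node true q) n) →
                             Shortest P → T₁ s x → Valid r x → InBranch p c s → ¬ InBranch p c q →
                             node true p ∈ verts P
  shortest-visits-ancestor q<r P shortest t₁ valid s-branch ¬q-branch
    with m , m≤ , W ← walk-from-T₁ q<r t₁ valid =
    tight-walk-visits-ancestor q<r P t₁ (≤-trans (shortest m W) m≤) s-branch ¬q-branch

-- Blocking in a mutual-visibility set

node-injective : ∀ {c w w′} → node c w ≡ node c w′ → w ≡ w′
node-injective refl = refl

qleaf-injective : ∀ {w w′} → qleaf w ≡ qleaf w′ → w ≡ w′
qleaf-injective refl = refl

module _ {r : ℕ} {S : Vtx → Set} (mv : IsMutualVisibility r S) where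

  hidden-behind : ∀ {p c q s x} → S (node true p) → S (node true q) → q ≢ p → ¬ InBranch p c q →
                  T₁ s x → InBranch p c s → ¬ S x
  hidden-behind Sp Sq q≢p ¬q-branch t₁ s-branch Sx
    with _ , P , shortest , clear ← proj₂ mv _ _ Sx Sq
    with lookup clear
           (shortest-visits-ancestor (proj₁ mv _ Sq) P shortest t₁ (proj₁ mv _ Sx) s-branch ¬q-branch) Sp
  ... | inj₁ refl with node₁ ← t₁ = InBranch-irrefl s-branch
  ... | inj₂ p≡q = q≢p (sym (node-injective p≡q))

-- Twin quasi-leaves away from a given vertex

sibling-quasi-leaves : ∀ {r} z → SameNeighbourhood r (qleaf (z ∷ʳ false)) (qleaf (z ∷ʳ true))
sibling-quasi-leaves {r} z x = mk⇔ (sibling-edge false true) (sibling-edge true false)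
  where
  sibling-parent : ∀ {y} b b′ → ParentOf r x y → y ≡ qleaf (z ∷ʳ b) → ParentOf r x (qleaf (z ∷ʳ b′))
  sibling-parent b b′ (toLeaf c w b″ w+1≡r) eq with refl ← ∷ʳ-injectiveˡ w z (qleaf-injective eq) =
    toLeaf c w b′ w+1≡r
  sibling-edge : ∀ b b′ → Edge r x (qleaf (z ∷ʳ b)) → Edge r x (qleaf (z ∷ʳ b′))
  sibling-edge b b′ (inj₁ parent) = inj₁ (sibling-parent b b′ parent refl)

descentRoot : List Bool → List Bool → List Bool
descentRoot w u with below? w u
... | yes (c , _) = w ∷ʳ not c
... | no _ = w

twinParent : ℕ → List Bool → List Bool → List Bool
twinParent r w u = descentRoot w u ++ replicate (r ∸ suc (length (descentRoot w u))) false

descentRoot-length : ∀ {r} w u → length w < r → length u < r → length (descentRoot w u) < r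
descentRoot-length {r} w u w<r u<r with below? w u
... | yes (c , u-branch) =
  subst (_< r) (sym (length-∷ʳ w (not c))) (≤-<-trans (InBranch-longer u-branch) u<r)
... | no _ = w<r

twinParent-length : ∀ r w u → length (descentRoot w u) < r → suc (length (twinParent r w u)) ≡ r
twinParent-length r w u d<r = begin
  suc (length (d ++ replicate k false))       ≡⟨ cong suc (length-++ d) ⟩
  suc (length d + length (replicate k false)) ≡⟨ cong (λ n → suc (length d + n)) (length-replicate k) ⟩
  suc (length d) + k                          ≡⟨ m+[n∸m]≡n d<r ⟩
  r                                           ∎
  where
  open ≡-Reasoning
  d : List Bool
  d = descentRoot w u
  k : ℕ
  k = r ∸ suc (length d)

AwayFrom : List Bool → List Bool → List Bool → Set
AwayFrom w u ℓ = ∃ λ c → InBranch w c ℓ × ¬ InBranch w c u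

twinParent-away : ∀ r w u β → AwayFrom w u (twinParent r w u ∷ʳ β)
twinParent-away r w u β with below? w u
... | yes (c , u-branch) =
  not c , (pad ∷ʳ β , trans (++-assoc (w ∷ʳ not c) pad [ β ]) (∷ʳ-++ w (not c) (pad ∷ʳ β))) ,
  λ u-branch′ → not-¬ refl (InBranch-functional u-branch u-branch′)
  where
  pad : List Bool
  pad = replicate (r ∸ suc (length (w ∷ʳ not c))) false
... | no ¬below with ∷ʳ-as-∷ (replicate (r ∸ suc (length w)) false) β
...   | c , t , eq =
  c , (t , trans (++-assoc w _ [ β ]) (cong (w ++_) eq)) , λ u-branch → ¬below (c , u-branch)

IsTwinPairIn : ℕ → (Vtx → Set) → Vtx → Vtx × Vtx → Set
IsTwinPairIn r S v p =
  IsQuasiLeaf r (proj₁ p) × IsQuasiLeaf r (proj₂ p) ×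
  proj₁ p ≢ proj₂ p × SameNeighbourhood r (proj₁ p) (proj₂ p) ×
  InSubtree v (proj₁ p) × InSubtree v (proj₂ p) × ¬ S (proj₁ p) × ¬ S (proj₂ p)

Disjoint : Vtx × Vtx → Vtx × Vtx → Set
Disjoint p p′ =
  (proj₁ p ≢ proj₁ p′) × (proj₁ p ≢ proj₂ p′) × (proj₂ p ≢ proj₁ p′) × (proj₂ p ≢ proj₂ p′)

address : Vtx → List Bool
address (node _ w) = w
address (qleaf w) = w

sibling-quasi-leaves-distinct : ∀ z → qleaf (z ∷ʳ false) ≢ qleaf (z ∷ʳ true)
sibling-quasi-leaves-distinct z eq with () ← ∷ʳ-injectiveʳ z z (qleaf-injective eq)

module TwinAssignment {r : ℕ} {S : Vtx → Set} (mv : IsMutualVisibility r S)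
  {q₁ q₂ : List Bool} (S₁ : S (node true q₁)) (S₂ : S (node true q₂)) (q₁≢q₂ : q₁ ≢ q₂) where

  partner : List Bool → List Bool
  partner w with ≡-dec _≟_ w q₁
  ... | yes _ = q₂
  ... | no _ = q₁

  partner-S : ∀ w → S (node true (partner w))
  partner-S w with ≡-dec _≟_ w q₁
  ... | yes _ = S₂
  ... | no _ = S₁

  partner-≢ : ∀ w → partner w ≢ w
  partner-≢ w with ≡-dec _≟_ w q₁
  ... | yes refl = λ q₂≡q₁ → q₁≢q₂ (sym q₂≡q₁)
  ... | no w≢q₁ = λ q₁≡w → w≢q₁ (sym q₁≡w)

  leaf : List Bool → Bool → List Bool
  leaf w β = twinParent r w (partner w) ∷ʳ β

  leaf-away : ∀ w β → AwayFrom w (partner w) (leaf w β)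
  leaf-away w = twinParent-away r w (partner w)

  leaf-depth : ∀ w β → length w < r → length (leaf w β) ≡ r
  leaf-depth w β w<r = trans (length-∷ʳ (twinParent r w (partner w)) β)
    (twinParent-length r w (partner w)
      (descentRoot-length w (partner w) w<r (proj₁ mv _ (partner-S w))))

  leaf-subtree : ∀ w β → ∃ λ s → leaf w β ≡ w ++ s
  leaf-subtree w β with c , (t , ℓ≡) , _ ← leaf-away w β = c ∷ t , ℓ≡

  leaf-∉S : ∀ {w} β → S (node true w) → ¬ S (qleaf (leaf w β))
  leaf-∉S {w} β Sw with _ , ℓ-branch , ¬u-branch ← leaf-away w β =
    hidden-behind mv Sw (partner-S w) (partner-≢ w) ¬u-branch qleaf₁ ℓ-branch

  leaf-owner-unique : ∀ {w w′ β β′} → S (node true w) → S (node true w′) →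
                      leaf w β ≡ leaf w′ β′ → w ≡ w′
  leaf-owner-unique {w} {w′} {β} {β′} Sw Sw′ eq
    with _ , (_ , ℓ≡) , ¬u-branch ← leaf-away w β
    with _ , (_ , ℓ≡′) , ¬u-branch′ ← leaf-away w′ β′
    with extensions-comparable w w′ (trans (sym ℓ≡) (trans eq ℓ≡′))
  ... | inj₁ w≡w′ = w≡w′
  ... | inj₂ (inj₁ w′-branch) =
    ⊥-elim (hidden-behind mv Sw (partner-S w) (partner-≢ w) ¬u-branch node₁ w′-branch Sw′)
  ... | inj₂ (inj₂ w-branch) =
    ⊥-elim (hidden-behind mv Sw′ (partner-S w′) (partner-≢ w′) ¬u-branch′ node₁ w-branch Sw)

  assign : Vtx → Vtx × Vtx
  assign v = qleaf (leaf (address v) false) , qleaf (leaf (address v) true)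

  assign-twins : ∀ v → S v → InV1 r v → IsTwinPairIn r S v (assign v)
  assign-twins (node true w) Sw w<r =
    leaf-depth w false w<r , leaf-depth w true w<r ,
    sibling-quasi-leaves-distinct _ , sibling-quasi-leaves _ ,
    leaf-subtree w false , leaf-subtree w true ,
    leaf-∉S false Sw , leaf-∉S true Sw

  assign-disjoint : ∀ v v′ → S v → InV1 r v → S v′ → InV1 r v′ → v ≢ v′ →
                    Disjoint (assign v) (assign v′)
  assign-disjoint (node true w) (node true w′) Sw _ Sw′ _ v≢v′ =
    apart false false , apart false true , apart true false , apart true true
    where
    apart : ∀ β β′ → qleaf (leaf w β) ≢ qleaf (leaf w′ β′)
    apart β β′ eq = v≢v′ (cong (node true) (leaf-owner-unique Sw Sw′ (qleaf-injective eq)))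

mainTheorem2 : (r : ℕ) → 2 ≤ r → (S : Vtx → Set) → IsMutualVisibility r S →
    (Σ Vtx λ v₁ → Σ Vtx λ v₂ → v₁ ≢ v₂ × S v₁ × InV1 r v₁ × S v₂ × InV1 r v₂) →
    Σ (Vtx → Vtx × Vtx) λ f →
      (∀ v → S v → InV1 r v →
        IsQuasiLeaf r (proj₁ (f v)) × IsQuasiLeaf r (proj₂ (f v)) ×
        proj₁ (f v) ≢ proj₂ (f v) × SameNeighbourhood r (proj₁ (f v)) (proj₂ (f v)) ×
        InSubtree v (proj₁ (f v)) × InSubtree v (proj₂ (f v)) ×
        ¬ S (proj₁ (f v)) × ¬ S (proj₂ (f v))) ×
      (∀ v v′ → S v → InV1 r v → S v′ → InV1 r v′ → v ≢ v′ →
        (proj₁ (f v) ≢ proj₁ (f v′)) × (proj₁ (f v) ≢ proj₂ (f v′)) ×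
        (proj₂ (f v) ≢ proj₁ (f v′)) × (proj₂ (f v) ≢ proj₂ (f v′)))
mainTheorem2 r _ S mv (node true q₁ , node true q₂ , v₁≢v₂ , S₁ , _ , S₂ , _) =
  assign , assign-twins , assign-disjoint
  where open TwinAssignment mv S₁ S₂ (λ q₁≡q₂ → v₁≢v₂ (cong (node true) q₁≡q₂))
mainTheorem2 _ _ _ _ (node false _ , _ , _ , _ , () , _)
mainTheorem2 _ _ _ _ (qleaf _ , _ , _ , _ , () , _)
mainTheorem2 _ _ _ _ (node true _ , node false _ , _ , _ , _ , _ , ())
mainTheorem2 _ _ _ _ (node true _ , qleaf _ , _ , _ , _ , _ , ())
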